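{- Let $w$ be an infinite binary word such that for every factor $u$ of $w$, $\overline{u}$ is a factor of $w$ or $\overline{u^{\rm rev}}$ is a factor of $w$. Then $F^1_w(n)=F^0_w(n)$ for all $n\ge1$, $\mathrm{PNF}_0(w)=\overline{\mathrm{PNF}_1(w)}$, and $F^1_w(n)=(\psi_w(n)+n-1)/2$ for all $n\ge1$.
   Context: Binary words are indexed from $1$. For a finite word $u=u_1\cdots u_n$, $u^{\rm rev}=u_n\cdots u_1$ and $\overline{u}$ is the complement obtained by replacing each letter $a$ with $1-a$ (complement is defined letterwise also for infinite words). $F^1_w(i)$ (resp. $F^0_w(i)$) is the maximum number of $1$s (resp. $0$s) in a factor of $w$ of length $i$, with $F^a_w(0)=0$. The prefix normal forms are $\mathrm{PNF}_1(w)=w'$, $\mathrm{PNF}_0(w)=w''$ with $w'_n=F^1_w(n)-F^1_w(n-1)$ and $w''_n=1-(F^0_w(n)-F^0_w(n-1))$ for $n\ge1$. The abelian complexity $\psi_w(n)$ is the number of distinct pairs $(|u|_0,|u|_1)$ over factors $u$ of $w$ of length $n$. -}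

module Defs where

open import Data.Bool using (Bool; true; false; not)
open import Data.Nat using (ℕ; zero; suc; _+_; _≤_)
open import Data.Product using (Σ; ∃; _×_; _,_)
open import Data.List using (List; []; _∷_; map; upTo; length)
open import Data.List.Membership.Propositional using (_∈_)
open import Data.List.Relation.Unary.Unique.Propositional using (Unique)
open import Function.Bundles using (_⇔_)
open import Relation.Binary.PropositionalEquality using (_≡_)

-- Infinite binary words: w : ℕ → Bool, with w 0 the first letter
-- (the paper's position i is w (i - 1)); true = 1, false = 0.
Word : Set
Word = ℕ → Bool

fac : Word → ℕ → ℕ → List Bool
fac w i n = map (λ k → w (i + k)) (upTo n)

Factor : List Bool → Word → Set
Factor u w = ∃ λ i → fac w i (length u) ≡ u

ones : List Bool → ℕ
ones [] = 0
ones (true ∷ u) = suc (ones u)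
ones (false ∷ u) = ones u

zeros : List Bool → ℕ
zeros [] = 0
zeros (true ∷ u) = zeros u
zeros (false ∷ u) = suc (zeros u)

compl : List Bool → List Bool
compl = map not

F1 : Word → ℕ → ℕ → Set
F1 w n m = (∃ λ i → ones (fac w i n) ≡ m) × (∀ i → ones (fac w i n) ≤ m)

F0 : Word → ℕ → ℕ → Set
F0 w n m = (∃ λ i → zeros (fac w i n) ≡ m) × (∀ i → zeros (fac w i n) ≤ m)

bit : Bool → ℕ
bit true = 1
bit false = 0

-- v = PNF₁(w): letter n+1 of v (i.e. v n) equals F¹(n+1) - F¹(n)
IsPNF1 : Word → Word → Set
IsPNF1 w v = ∀ n a a′ → F1 w (suc n) a → F1 w n a′ → bit (v n) + a′ ≡ a

-- v = PNF₀(w): v n equals 1 - (F⁰(n+1) - F⁰(n))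
IsPNF0 : Word → Word → Set
IsPNF0 w v = ∀ n a a′ → F0 w (suc n) a → F0 w n a′ → bit (not (v n)) + a′ ≡ a

parikh : List Bool → ℕ × ℕ
parikh u = zeros u , ones u

Psi : Word → ℕ → ℕ → Set
Psi w n c = Σ (List (ℕ × ℕ)) λ L →
  Unique L × (∀ p → (p ∈ L) ⇔ (∃ λ i → parikh (fac w i n) ≡ p)) × (length L ≡ c)

module Submission where

-- Under the hypothesis, swapping (|u|₀ , |u|₁) ↦ (|u|₁ , |u|₀) maps the Parikh vectors of the
-- length-n factors onto themselves. Hence the largest number of 0s equals the largest number
-- a = F¹(n) of 1s, which gives the PNF identity, and the smallest number of 1s is n − a.
-- Sliding a window by one position changes its number of 1s by at most one, so every value
-- between n − a and a occurs, giving ψ(n) = a − (n − a) + 1.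

open import Defs
open import Data.Bool using (Bool; true; false; not)
open import Data.Bool.Properties using (not-involutive) renaming (_≟_ to _≟ᵇ_)
open import Data.Nat using (ℕ; zero; suc; _+_; _*_; _∸_; _≤_; _<_; z≤n; s≤s)
open import Data.Nat.Properties
open import Data.Nat.ListAction using (sum)
open import Data.Nat.ListAction.Properties using (sum-↭)
open import Data.Product using (∃; _×_; _,_; proj₁; proj₂; swap)
open import Data.Sum using (_⊎_; inj₁; inj₂)
open import Data.List using (List; []; _∷_; _∷ʳ_; [_]; map; length; reverse; applyUpTo; upTo)
open import Data.List.Properties
  using (length-map; length-upTo; length-reverse; length-applyUpTo; map-++; map-applyUpTo; map-cong; upTo-∷ʳ; reverse-map)
open import Data.List.Membership.Propositional using (_∈_)
open import Data.List.Membership.Propositional.Properties using (∈-applyUpTo⁺; ∈-applyUpTo⁻)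
open import Data.List.Membership.Propositional.Properties.WithK using (unique∧set⇒bag)
open import Data.List.Relation.Binary.BagAndSetEquality using (∼bag⇒↭)
open import Data.List.Relation.Binary.Permutation.Propositional.Properties using (↭-length; ↭-reverse)
open import Data.List.Relation.Unary.Unique.Propositional using (Unique)
open import Data.List.Relation.Unary.Unique.Propositional.Properties using (applyUpTo⁺₁)
open import Function using (_∘_)
open import Function.Bundles using (_⇔_; mk⇔; Equivalence)
import Function.Properties.Equivalence as ⇔
open import Relation.Binary.PropositionalEquality using (_≡_; refl; sym; trans; cong; cong₂; subst; module ≡-Reasoning)
open import Relation.Nullary using (¬_; yes; no)
open import Relation.Nullary.Decidable using (¬¬-excluded-middle; decidable-stable)

IsMaximum : (ℕ → ℕ) → ℕ → Set
IsMaximum f m = (∃ λ i → f i ≡ m) × (∀ i → f i ≤ m)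

IsMaximum-unique : ∀ {f m m′} → IsMaximum f m → IsMaximum f m′ → m ≡ m′
IsMaximum-unique ((i , fi≡m) , ≤m) ((j , fj≡m′) , ≤m′) =
  ≤-antisym (subst (_≤ _) fi≡m (≤m′ i)) (subst (_≤ _) fj≡m′ (≤m j))

IsMaximum-sameValues : ∀ {f g m} →
  (∀ i → ∃ λ j → g j ≡ f i) → (∀ j → ∃ λ i → f i ≡ g j) → IsMaximum f m → IsMaximum g m
IsMaximum-sameValues f⊆g g⊆f ((i , fi≡m) , ≤m) =
  (proj₁ (f⊆g i) , trans (proj₂ (f⊆g i)) fi≡m) ,
  λ j → subst (_≤ _) (proj₂ (g⊆f j)) (≤m (proj₁ (g⊆f j)))

-- Maxima of bounded functions ℕ → ℕ exist only classically, hence the double negation.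
¬¬-maximum : ∀ (f : ℕ → ℕ) B → (∀ i → f i ≤ B) → ¬ ¬ ∃ (IsMaximum f)
¬¬-maximum f zero f≤0 ¬max = ¬max (0 , (0 , n≤0⇒n≡0 (f≤0 0)) , f≤0)
¬¬-maximum f (suc B) f≤B ¬max = ¬¬-excluded-middle λ where
  (yes attained) → ¬max (suc B , attained , f≤B)
  (no ¬attained) → ¬¬-maximum f B (λ i → ≤-pred (≤∧≢⇒< (f≤B i) (λ e → ¬attained (i , e)))) ¬max

UnitSteps : (ℕ → ℕ) → Set
UnitSteps f = ∀ p → f (suc p) ≤ suc (f p) × f p ≤ suc (f (suc p))

module _ {f : ℕ → ℕ} (steps : UnitSteps f) {t : ℕ} where

  private
    walk-up : ∀ d i → f i ≤ t → t ≤ f (d + i) → ∃ λ p → f p ≡ t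
    walk-up zero i fi≤t t≤fi = i , ≤-antisym fi≤t t≤fi
    walk-up (suc d) i fi≤t t≤f with t ≤? f i
    ... | yes t≤fi = i , ≤-antisym fi≤t t≤fi
    ... | no t≰fi = walk-up d (suc i) (≤-trans (proj₁ (steps i)) (≰⇒> t≰fi))
                      (subst (λ q → t ≤ f q) (sym (+-suc d i)) t≤f)

    walk-down : ∀ d i → t ≤ f i → f (d + i) ≤ t → ∃ λ p → f p ≡ t
    walk-down zero i t≤fi fi≤t = i , ≤-antisym fi≤t t≤fi
    walk-down (suc d) i t≤fi f≤t with f i ≤? t
    ... | yes fi≤t = i , ≤-antisym fi≤t t≤fi
    ... | no fi≰t = walk-down d (suc i) (≤-pred (≤-trans (≰⇒> fi≰t) (proj₂ (steps i))))
                      (subst (λ q → f q ≤ t) (sym (+-suc d i)) f≤t)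

  intermediate-value : ∀ i j → f i ≤ t → t ≤ f j → ∃ λ p → f p ≡ t
  intermediate-value i j fi≤t t≤fj with ≤-total i j
  ... | inj₁ i≤j = walk-up (j ∸ i) i fi≤t (subst (λ q → t ≤ f q) (sym (m∸n+n≡m i≤j)) t≤fj)
  ... | inj₂ j≤i = walk-down (i ∸ j) j t≤fj (subst (λ q → f q ≤ t) (sym (m∸n+n≡m j≤i)) fi≤t)

unit-steps-from-slide : ∀ {x y b b′} → x + b′ ≡ b + y → b ≤ 1 → b′ ≤ 1 → y ≤ suc x × x ≤ suc y
unit-steps-from-slide {x} {y} {b} {b′} slide b≤1 b′≤1 =
  ≤-trans (m≤n+m y b) (subst (_≤ suc x) slide (subst (x + b′ ≤_) (+-comm x 1) (+-monoʳ-≤ x b′≤1))) ,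
  ≤-trans (m≤m+n x b′) (subst (_≤ suc y) (sym slide) (+-monoˡ-≤ y b≤1))

same-members⇒length≡ : ∀ {A : Set} {xs ys : List A} →
  Unique xs → Unique ys → (∀ {x} → x ∈ xs ⇔ x ∈ ys) → length xs ≡ length ys
same-members⇒length≡ xs! ys! same = ↭-length (∼bag⇒↭ (unique∧set⇒bag xs! ys! same))

∈-applyUpTo-interval : ∀ {A : Set} (g : ℕ → A) {lo hi x} → lo ≤ suc hi →
  x ∈ applyUpTo (g ∘ (lo +_)) (suc hi ∸ lo) ⇔ ∃ λ t → (lo ≤ t × t ≤ hi) × g t ≡ x
∈-applyUpTo-interval g {lo} {hi} {x} lo≤hi+1 = mk⇔ to from
  where
  to : x ∈ applyUpTo (g ∘ (lo +_)) (suc hi ∸ lo) → ∃ λ t → (lo ≤ t × t ≤ hi) × g t ≡ x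
  to x∈ with ∈-applyUpTo⁻ (g ∘ (lo +_)) x∈
  ... | k , k<len , x≡ =
    lo + k , (m≤m+n lo k , ≤-pred (subst (lo + k <_) (m+[n∸m]≡n lo≤hi+1) (+-monoʳ-< lo k<len))) , sym x≡
  from : (∃ λ t → (lo ≤ t × t ≤ hi) × g t ≡ x) → x ∈ applyUpTo (g ∘ (lo +_)) (suc hi ∸ lo)
  from (t , (lo≤t , t≤hi) , gt≡x) =
    subst (_∈ _) (trans (cong g (m+[n∸m]≡n lo≤t)) gt≡x) (∈-applyUpTo⁺ (g ∘ (lo +_)) (∸-monoˡ-< (s≤s t≤hi) lo≤t))

two-max≡range+length : ∀ {lo a n} → lo ≤ a → lo + a ≡ suc n → 2 * a ≡ (suc a ∸ lo) + n
two-max≡range+length {lo} {a} {n} lo≤a lo+a≡1+n = suc-injective (begin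
  suc (2 * a)           ≡⟨ cong (suc ∘ (a +_)) (+-identityʳ a) ⟩
  suc a + a             ≡⟨ cong (_+ a) (sym (m∸n+n≡m (m≤n⇒m≤1+n lo≤a))) ⟩
  range + lo + a        ≡⟨ +-assoc range lo a ⟩
  range + (lo + a)      ≡⟨ cong (range +_) lo+a≡1+n ⟩
  range + suc n         ≡⟨ +-suc range n ⟩
  suc (range + n)       ∎)
  where
  open ≡-Reasoning
  range = suc a ∸ lo

bit≤1 : ∀ x → bit x ≤ 1
bit≤1 true = s≤s z≤n
bit≤1 false = z≤n

bit-injective : ∀ {x y} → bit x ≡ bit y → x ≡ y
bit-injective {true} {true} _ = refl
bit-injective {false} {false} _ = refl

ones-∷ : ∀ x u → ones (x ∷ u) ≡ bit x + ones u
ones-∷ true u = refl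
ones-∷ false u = refl

ones-∷ʳ : ∀ u x → ones (u ∷ʳ x) ≡ ones u + bit x
ones-∷ʳ [] true = refl
ones-∷ʳ [] false = refl
ones-∷ʳ (true ∷ u) x = cong suc (ones-∷ʳ u x)
ones-∷ʳ (false ∷ u) x = ones-∷ʳ u x

ones≡sum-bit : ∀ u → ones u ≡ sum (map bit u)
ones≡sum-bit [] = refl
ones≡sum-bit (true ∷ u) = cong suc (ones≡sum-bit u)
ones≡sum-bit (false ∷ u) = ones≡sum-bit u

ones-reverse : ∀ u → ones (reverse u) ≡ ones u
ones-reverse u = begin
  ones (reverse u)            ≡⟨ ones≡sum-bit (reverse u) ⟩
  sum (map bit (reverse u))   ≡⟨ cong sum (reverse-map bit u) ⟩
  sum (reverse (map bit u))   ≡⟨ sum-↭ (↭-reverse (map bit u)) ⟩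
  sum (map bit u)             ≡⟨ sym (ones≡sum-bit u) ⟩
  ones u                      ∎
  where open ≡-Reasoning

ones-compl : ∀ u → ones (compl u) ≡ zeros u
ones-compl [] = refl
ones-compl (true ∷ u) = ones-compl u
ones-compl (false ∷ u) = cong suc (ones-compl u)

zeros-compl : ∀ u → zeros (compl u) ≡ ones u
zeros-compl [] = refl
zeros-compl (true ∷ u) = cong suc (zeros-compl u)
zeros-compl (false ∷ u) = zeros-compl u

zeros-reverse : ∀ u → zeros (reverse u) ≡ zeros u
zeros-reverse u = begin
  zeros (reverse u)          ≡⟨ sym (ones-compl (reverse u)) ⟩
  ones (compl (reverse u))   ≡⟨ cong ones (reverse-map not u) ⟩
  ones (reverse (compl u))   ≡⟨ ones-reverse (compl u) ⟩
  ones (compl u)             ≡⟨ ones-compl u ⟩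
  zeros u                    ∎
  where open ≡-Reasoning

zeros+ones≡length : ∀ u → zeros u + ones u ≡ length u
zeros+ones≡length [] = refl
zeros+ones≡length (true ∷ u) = trans (+-suc (zeros u) (ones u)) (cong suc (zeros+ones≡length u))
zeros+ones≡length (false ∷ u) = cong suc (zeros+ones≡length u)

parikh-compl : ∀ u → parikh (compl u) ≡ swap (parikh u)
parikh-compl u = cong₂ _,_ (zeros-compl u) (ones-compl u)

parikh-reverse : ∀ u → parikh (reverse u) ≡ parikh u
parikh-reverse u = cong₂ _,_ (zeros-reverse u) (ones-reverse u)

length-fac : ∀ w i n → length (fac w i n) ≡ n
length-fac w i n = trans (length-map _ (upTo n)) (length-upTo n)

fac-suc : ∀ w i n → fac w i (suc n) ≡ w i ∷ fac w (suc i) n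
fac-suc w i n = begin
  fac w i (suc n)
    ≡⟨ map-applyUpTo (λ k → k) window (suc n) ⟩
  window 0 ∷ applyUpTo (window ∘ suc) n
    ≡⟨ cong₂ _∷_ (cong w (+-identityʳ i)) (sym (map-applyUpTo (λ k → k) (window ∘ suc) n)) ⟩
  w i ∷ map (window ∘ suc) (upTo n)
    ≡⟨ cong (w i ∷_) (map-cong (λ k → cong w (+-suc i k)) (upTo n)) ⟩
  w i ∷ fac w (suc i) n
    ∎
  where
  open ≡-Reasoning
  window : ℕ → Bool
  window k = w (i + k)

fac-∷ʳ : ∀ w i n → fac w i (suc n) ≡ fac w i n ∷ʳ w (i + n)
fac-∷ʳ w i n = trans (cong (map window) (sym (upTo-∷ʳ n))) (map-++ window (upTo n) [ n ])
  where
  window : ℕ → Bool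
  window k = w (i + k)

ones-slide : ∀ w i n → ones (fac w i n) + bit (w (i + n)) ≡ bit (w i) + ones (fac w (suc i) n)
ones-slide w i n = begin
  ones (fac w i n) + bit (w (i + n))   ≡⟨ sym (ones-∷ʳ (fac w i n) (w (i + n))) ⟩
  ones (fac w i n ∷ʳ w (i + n))        ≡⟨ cong ones (sym (fac-∷ʳ w i n)) ⟩
  ones (fac w i (suc n))               ≡⟨ cong ones (fac-suc w i n) ⟩
  ones (w i ∷ fac w (suc i) n)         ≡⟨ ones-∷ (w i) (fac w (suc i) n) ⟩
  bit (w i) + ones (fac w (suc i) n)   ∎
  where open ≡-Reasoning

ones-fac≤length : ∀ w i n → ones (fac w i n) ≤ n
ones-fac≤length w i n =
  subst (ones u ≤_) (trans (zeros+ones≡length u) (length-fac w i n)) (m≤n+m (ones u) (zeros u))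
  where u = fac w i n

zeros-fac : ∀ w i n → zeros (fac w i n) ≡ n ∸ ones (fac w i n)
zeros-fac w i n =
  trans (sym (m+n∸n≡m (zeros u) (ones u))) (cong (_∸ ones u) (trans (zeros+ones≡length u) (length-fac w i n)))
  where u = fac w i n

fac-factor : ∀ w i n → Factor (fac w i n) w
fac-factor w i n = i , cong (fac w i) (length-fac w i n)

parikh-of-factor : ∀ w {v n p} →
  Factor v w → length v ≡ n → parikh v ≡ p → ∃ λ j → parikh (fac w j n) ≡ p
parikh-of-factor w (j , fac≡v) refl parikh≡p = j , trans (cong parikh fac≡v) parikh≡p

ComplementClosedUpToReversal : Word → Set
ComplementClosedUpToReversal w =
  ∀ (u : List Bool) → Factor u w → Factor (compl u) w ⊎ Factor (compl (reverse u)) w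

module _ (w : Word) (closed : ComplementClosedUpToReversal w) where

  parikh-swap-attained : ∀ n i → ∃ λ j → parikh (fac w j n) ≡ swap (parikh (fac w i n))
  parikh-swap-attained n i = swapped (closed u (fac-factor w i n))
    where
    u = fac w i n
    swapped : Factor (compl u) w ⊎ Factor (compl (reverse u)) w →
              ∃ λ j → parikh (fac w j n) ≡ swap (parikh u)
    swapped (inj₁ factor) =
      parikh-of-factor w factor (trans (length-map not u) (length-fac w i n)) (parikh-compl u)
    swapped (inj₂ factor) =
      parikh-of-factor w factor
        (trans (length-map not (reverse u)) (trans (length-reverse u) (length-fac w i n)))
        (trans (parikh-compl (reverse u)) (cong swap (parikh-reverse u)))

  F1⇒F0 : ∀ {n a} → F1 w n a → F0 w n a
  F1⇒F0 {n} = IsMaximum-sameValues {f = λ i → ones (fac w i n)} {g = λ i → zeros (fac w i n)}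
    (λ i → proj₁ (parikh-swap-attained n i) , cong proj₁ (proj₂ (parikh-swap-attained n i)))
    (λ j → proj₁ (parikh-swap-attained n j) , cong proj₂ (proj₂ (parikh-swap-attained n j)))

  F1≡F0 : ∀ {n a b} → F1 w n a → F0 w n b → a ≡ b
  F1≡F0 {n} max₁ max₀ = IsMaximum-unique {f = λ i → zeros (fac w i n)} (F1⇒F0 {n} max₁) max₀

  ¬¬-F1 : ∀ n → ¬ ¬ ∃ (F1 w n)
  ¬¬-F1 n = ¬¬-maximum (λ i → ones (fac w i n)) n (λ i → ones-fac≤length w i n)

  PNF0≡compl-PNF1 : ∀ {v v′} → IsPNF1 w v → IsPNF0 w v′ → ∀ k → v′ k ≡ not (v k)
  PNF0≡compl-PNF1 {v} {v′} pnf₁ pnf₀ k = decidable-stable (v′ k ≟ᵇ not (v k)) λ v′k≢ →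
    ¬¬-F1 (suc k) λ (a , max) → ¬¬-F1 k λ (a′ , max′) →
      let bits≡ : bit (not (v′ k)) ≡ bit (v k)
          bits≡ = +-cancelʳ-≡ a′ _ _
            (trans (pnf₀ k a a′ (F1⇒F0 {suc k} max) (F1⇒F0 {k} max′)) (sym (pnf₁ k a a′ max max′)))
      in v′k≢ (trans (sym (not-involutive (v′ k))) (cong not (bit-injective bits≡)))

  module _ {n a : ℕ} (max : F1 w n a) where

    weight : ℕ → ℕ
    weight p = ones (fac w p n)

    minWeight : ℕ
    minWeight = n ∸ a

    max≤length : a ≤ n
    max≤length = subst (_≤ n) (proj₂ (proj₁ max)) (ones-fac≤length w (proj₁ (proj₁ max)) n)

    -- The maximal number of 0s is a as well, so the minimal number of 1s is n ∸ a.
    minWeight≤weight : ∀ p → minWeight ≤ weight p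
    minWeight≤weight p =
      subst (minWeight ≤_) (m∸[m∸n]≡n (ones-fac≤length w p n))
        (∸-monoʳ-≤ n (subst (_≤ a) (zeros-fac w p n) (proj₂ (F1⇒F0 {n} max) p)))

    minWeight-attained : ∃ λ j → weight j ≡ minWeight
    minWeight-attained =
      j , trans (sym (m∸[m∸n]≡n (ones-fac≤length w j n))) (cong (n ∸_) (trans (sym (zeros-fac w j n)) zeros≡a))
      where
      j = proj₁ (proj₁ (F1⇒F0 {n} max))
      zeros≡a = proj₂ (proj₁ (F1⇒F0 {n} max))

    minWeight≤max : minWeight ≤ a
    minWeight≤max = subst (minWeight ≤_) (proj₂ (proj₁ max)) (minWeight≤weight (proj₁ (proj₁ max)))

    weight-unitSteps : UnitSteps weight
    weight-unitSteps p = unit-steps-from-slide (ones-slide w p n) (bit≤1 (w p)) (bit≤1 (w (p + n)))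

    weight-attained⇔ : ∀ t → (∃ λ p → weight p ≡ t) ⇔ (minWeight ≤ t × t ≤ a)
    weight-attained⇔ t = mk⇔
      (λ (p , weight≡t) →
         subst (minWeight ≤_) weight≡t (minWeight≤weight p) , subst (_≤ a) weight≡t (proj₂ max p))
      (λ (min≤t , t≤max) → intermediate-value weight-unitSteps (proj₁ minWeight-attained) (proj₁ (proj₁ max))
         (subst (_≤ t) (sym (proj₂ minWeight-attained)) min≤t) (subst (t ≤_) (sym (proj₂ (proj₁ max))) t≤max))

    vectorOfWeight : ℕ → ℕ × ℕ
    vectorOfWeight t = n ∸ t , t

    parikh-window : ∀ p → parikh (fac w p n) ≡ vectorOfWeight (weight p)
    parikh-window p = cong (_, weight p) (zeros-fac w p n)

    parikhVectors : List (ℕ × ℕ)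
    parikhVectors = applyUpTo (vectorOfWeight ∘ (minWeight +_)) (suc a ∸ minWeight)

    parikhVectors-unique : Unique parikhVectors
    parikhVectors-unique =
      applyUpTo⁺₁ _ _ λ i<j _ same → <⇒≢ i<j (+-cancelˡ-≡ minWeight _ _ (cong proj₂ same))

    ∈-parikhVectors⇔ : ∀ x → x ∈ parikhVectors ⇔ ∃ λ p → parikh (fac w p n) ≡ x
    ∈-parikhVectors⇔ x =
      ⇔.trans (∈-applyUpTo-interval vectorOfWeight (m≤n⇒m≤1+n minWeight≤max)) (mk⇔ to from)
      where
      to : (∃ λ t → (minWeight ≤ t × t ≤ a) × vectorOfWeight t ≡ x) → ∃ λ p → parikh (fac w p n) ≡ x
      to (t , bounds , vector≡x) with Equivalence.from (weight-attained⇔ t) bounds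
      ... | p , weight≡t = p , trans (parikh-window p) (trans (cong vectorOfWeight weight≡t) vector≡x)
      from : (∃ λ p → parikh (fac w p n) ≡ x) → ∃ λ t → (minWeight ≤ t × t ≤ a) × vectorOfWeight t ≡ x
      from (p , parikh≡x) =
        weight p , Equivalence.to (weight-attained⇔ (weight p)) (p , refl) , trans (sym (parikh-window p)) parikh≡x

    abelian-complexity : ∀ {c} → Psi w n c → c ≡ suc a ∸ minWeight
    abelian-complexity (vectors , vectors-unique , ∈vectors⇔ , refl) =
      trans (same-members⇒length≡ vectors-unique parikhVectors-unique
               (λ {x} → ⇔.trans (∈vectors⇔ x) (⇔.sym (∈-parikhVectors⇔ x))))
            (length-applyUpTo _ _)

  twice-max≡complexity+length∸1 : ∀ {n a c} → 1 ≤ n → F1 w n a → Psi w n c → 2 * a ≡ c + (n ∸ 1)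
  twice-max≡complexity+length∸1 {suc n} (s≤s z≤n) max ψ =
    trans (two-max≡range+length (minWeight≤max max) (m∸n+n≡m (max≤length max)))
          (cong (_+ n) (sym (abelian-complexity max ψ)))

lemma9 : (w : Word) →
    (∀ (u : List Bool) → Factor u w → Factor (compl u) w ⊎ Factor (compl (reverse u)) w) →
    (∀ (n a b : ℕ) → 1 ≤ n → F1 w n a → F0 w n b → a ≡ b)
    × (∀ (v v′ : Word) → IsPNF1 w v → IsPNF0 w v′ → ∀ (k : ℕ) → v′ k ≡ not (v k))
    × (∀ (n a c : ℕ) → 1 ≤ n → F1 w n a → Psi w n c → 2 * a ≡ c + (n ∸ 1))
lemma9 w closed =
  (λ n a b _ → F1≡F0 w closed {n} {a} {b}) ,
  (λ v v′ → PNF0≡compl-PNF1 w closed {v} {v′}) ,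
  (λ n a c → twice-max≡complexity+length∸1 w closed {n} {a} {c})
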